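{- Let $X$ be either the set of top/left boundary vertices of $H$ or the set of bottom/right boundary vertices of $H$ (both restricted to the outside of $Q$). Let $u,v\in X$ belong to distinct Voronoi cells. If $u$ precedes $v$ (in $X$) then the site $s_u \in U$ of $u$ precedes (in $U$) the site $s_v \in U$ of $v$.
   Context: Let $G$ be the alignment graph of two strings (a grid with vertices $(x,y)$, unit edges right, down, and diagonal down-right on matching letters; paths go only right and/or down), recursively decomposed into rectangular pieces. For a piece $P$, boundary vertices are those with neighbours outside $P$; the top/left boundary of $P$ is the set of boundary vertices that are leftmost or topmost in $P$, and the bottom/right boundary is the set of boundary vertices that are rightmost or bottommost in $P$; each is ordered so that adjacent vertices are consecutive and the earliest vertex is the bottom-left one. The outside of $P$ is the set of vertices of $G$ that are not internal vertices of $P$ and are reachable from some vertex of $P$. Fix a piece $Q$ and consider the additively weighted Voronoi diagram of the outside of $Q$ with sites a subsequence $U$ of the bottom/right boundary of $Q$ (with nonnegative additive weights; ties broken in favor of the site $(x,y)$ with lexicographically largest (weight, $x$, $y$), so for every vertex $a$ in the cell of site $s_a$, all vertices on the shortest $s_a$-to-$a$ path are in that cell). $H$ is a piece of the decomposition, considered only via its intersection with the outside of $Q$ (and likewise its boundary sets). -}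

module Defs where

open import Data.Nat using (ℕ; zero; suc; _+_; _∸_; _≤_; _<_)
open import Data.Fin using (fromℕ<)
open import Data.Vec using (Vec; lookup)
open import Data.Product using (Σ; ∃; _×_; _,_)
open import Data.Sum using (_⊎_)
open import Relation.Nullary using (¬_)
open import Relation.Binary.PropositionalEquality using (_≡_; _≢_)

-- Vertices of the alignment graph: points (x , y) of ℕ × ℕ.
-- x grows to the right, y grows downwards.

record Vertex : Set where
  constructor ⟨_,_⟩
  field
    vx : ℕ
    vy : ℕ
open Vertex public

module Alignment {A : Set} {m n : ℕ} (a : Vec A m) (b : Vec A n) where

  InG : Vertex → Set
  InG v = (vx v ≤ m) × (vy v ≤ n)

  -- letters a[x+1] and b[y+1] (1-indexed) match
  Match : ℕ → ℕ → Set
  Match x y = Σ (x < m) λ p → Σ (y < n) λ q →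
                lookup a (fromℕ< p) ≡ lookup b (fromℕ< q)

  data Edge : Vertex → Vertex → Set where
    right : ∀ {x y} → suc x ≤ m → y ≤ n → Edge ⟨ x , y ⟩ ⟨ suc x , y ⟩
    down  : ∀ {x y} → x ≤ m → suc y ≤ n → Edge ⟨ x , y ⟩ ⟨ x , suc y ⟩
    diag  : ∀ {x y} → Match x y → Edge ⟨ x , y ⟩ ⟨ suc x , suc y ⟩

  data Path : Vertex → Vertex → ℕ → Set where
    []  : ∀ {v} → InG v → Path v v 0
    _∷_ : ∀ {u v w k} → Edge u v → Path v w k → Path u w (suc k)

  Reachable : Vertex → Vertex → Set
  Reachable s t = ∃ λ k → Path s t k

  IsDist : Vertex → Vertex → ℕ → Set
  IsDist s t d = Path s t d × (∀ k → Path s t k → d ≤ k)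

  Adj : Vertex → Vertex → Set
  Adj u v = Edge u v ⊎ Edge v u

  record Rect : Set where
    constructor rect
    field
      x0 x1 y0 y1 : ℕ
  open Rect public

  InRect : Rect → Vertex → Set
  InRect P v = (x0 P ≤ vx v) × (vx v ≤ x1 P) × (y0 P ≤ vy v) × (vy v ≤ y1 P)

  InPiece : Rect → Vertex → Set
  InPiece P v = InG v × InRect P v

  Boundary : Rect → Vertex → Set
  Boundary P v = InPiece P v × ∃ λ w → Adj v w × ¬ InPiece P w

  Internal : Rect → Vertex → Set
  Internal P v = InPiece P v × ¬ Boundary P v

  TopLeft : Rect → Vertex → Set
  TopLeft P v = Boundary P v × ((vx v ≡ x0 P) ⊎ (vy v ≡ y0 P))

  BottomRight : Rect → Vertex → Set
  BottomRight P v = Boundary P v × ((vx v ≡ x1 P) ⊎ (vy v ≡ y1 P))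

  data Side : Set where
    topLeftSide bottomRightSide : Side

  SideBoundary : Side → Rect → Vertex → Set
  SideBoundary topLeftSide     = TopLeft
  SideBoundary bottomRightSide = BottomRight

  -- Position of a vertex along the top/left (resp. bottom/right) boundary
  -- of P, counted from the bottom-left vertex (x0 , y1) with adjacent
  -- boundary vertices consecutive.
  pos : Rect → Vertex → ℕ
  pos P v = (vx v ∸ x0 P) + (y1 P ∸ vy v)

  Precedes : Rect → Vertex → Vertex → Set
  Precedes P u v = pos P u < pos P v

  Outside : Rect → Vertex → Set
  Outside P v = InG v × ¬ Internal P v
                × ∃ λ q → InPiece P q × Reachable q v

  data Decomp : Rect → Set where
    leaf   : ∀ {R} → Decomp R
    splitV : ∀ {x₀ x₁ y₀ y₁} c → x₀ < c → c < x₁ →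
             Decomp (rect x₀ c y₀ y₁) → Decomp (rect c x₁ y₀ y₁) →
             Decomp (rect x₀ x₁ y₀ y₁)
    splitH : ∀ {x₀ x₁ y₀ y₁} c → y₀ < c → c < y₁ →
             Decomp (rect x₀ x₁ y₀ c) → Decomp (rect x₀ x₁ c y₁) →
             Decomp (rect x₀ x₁ y₀ y₁)

  data PieceOf : ∀ {R} → Decomp R → Rect → Set where
    here   : ∀ {R} (D : Decomp R) → PieceOf D R
    inV₁   : ∀ {x₀ x₁ y₀ y₁ c p q D₁ D₂ P} → PieceOf D₁ P →
             PieceOf (splitV {x₀} {x₁} {y₀} {y₁} c p q D₁ D₂) P
    inV₂   : ∀ {x₀ x₁ y₀ y₁ c p q D₁ D₂ P} → PieceOf D₂ P →
             PieceOf (splitV {x₀} {x₁} {y₀} {y₁} c p q D₁ D₂) P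
    inH₁   : ∀ {x₀ x₁ y₀ y₁ c p q D₁ D₂ P} → PieceOf D₁ P →
             PieceOf (splitH {x₀} {x₁} {y₀} {y₁} c p q D₁ D₂) P
    inH₂   : ∀ {x₀ x₁ y₀ y₁ c p q D₁ D₂ P} → PieceOf D₂ P →
             PieceOf (splitH {x₀} {x₁} {y₀} {y₁} c p q D₁ D₂) P

  Whole : Rect
  Whole = rect 0 m 0 n

  -- Additively weighted Voronoi diagram of the outside of Q with sites U
  -- (a subset of the bottom/right boundary of Q, ordered as there) and
  -- weights w.  Ties are broken in favour of the site with
  -- lexicographically largest (weight , x , y).

  LexLe : ℕ × ℕ × ℕ → ℕ × ℕ × ℕ → Set
  LexLe (a₁ , b₁ , c₁) (a₂ , b₂ , c₂) =
    (a₁ < a₂) ⊎ ((a₁ ≡ a₂) × ((b₁ < b₂) ⊎ ((b₁ ≡ b₂) × (c₁ ≤ c₂))))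

  key : (Vertex → ℕ) → Vertex → ℕ × ℕ × ℕ
  key w s = (w s , vx s , vy s)

  InCell : Rect → (Vertex → Set) → (Vertex → ℕ) → Vertex → Vertex → Set
  InCell Q U w t s =
    Outside Q t × U s ×
    ∃ λ d → IsDist s t d ×
      (∀ s' d' → U s' → IsDist s' t d' →
         (w s + d < w s' + d')
         ⊎ ((w s + d ≡ w s' + d') × LexLe (key w s') (key w s)))

-- Write u ⪯ v when v lies weakly to the right of and above u.  Both boundary
-- sides of a rectangle are chains for ⪯, and on such a chain the boundary
-- order is ⪯.  So if u precedes v on the boundary of H but sᵤ does not
-- precede sᵥ on the boundary of Q, the monotone shortest paths sᵤ ⇝ u and
-- sᵥ ⇝ v start and end in opposite order and must meet at some vertex z.
-- Exchanging their tails gives paths sᵥ ⇝ z ⇝ u and sᵤ ⇝ z ⇝ v of the same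
-- total length, so both Voronoi comparisons are ties, and the tie-breaking
-- order, being antisymmetric, forces sᵤ = sᵥ.
module Submission where

open import Defs
open import Data.Nat using (ℕ; suc; _+_; _≤_; _<_; _<?_)
open import Data.Nat.Properties
open import Data.Nat.Induction using (<-rec)
open import Data.Nat.Tactic.RingSolver using (solve-∀)
open import Data.Vec using (Vec)
open import Data.Product using (_×_; _,_; ∃; proj₁; proj₂)
open import Data.Sum using (_⊎_; inj₁; inj₂)
open import Relation.Nullary using (¬_; yes; no; contradiction)
open import Relation.Nullary.Decidable using (decidable-stable)
open import Relation.Binary.Definitions using (DecidableEquality)
open import Relation.Binary.PropositionalEquality
  using (_≡_; _≢_; refl; sym; trans; cong)

vertex-≡ : ∀ {u v} → vx u ≡ vx v → vy u ≡ vy v → u ≡ v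
vertex-≡ {⟨ _ , _ ⟩} {⟨ _ , _ ⟩} refl refl = refl

_≟ᵥ_ : DecidableEquality Vertex
u ≟ᵥ v with vx u ≟ vx v | vy u ≟ vy v
... | yes x≡ | yes y≡ = yes (vertex-≡ x≡ y≡)
... | no x≢ | _ = no λ { refl → x≢ refl }
... | yes _ | no y≢ = no λ { refl → y≢ refl }

infix 4 _⪯_

_⪯_ : Vertex → Vertex → Set
u ⪯ v = vx u ≤ vx v × vy v ≤ vy u

same-column-comparable : ∀ {u v} → vx u ≡ vx v → u ⪯ v ⊎ v ⪯ u
same-column-comparable {u} {v} x≡ with ≤-total (vy u) (vy v)
... | inj₁ yᵤ≤yᵥ = inj₂ (≤-reflexive (sym x≡) , yᵤ≤yᵥ)
... | inj₂ yᵥ≤yᵤ = inj₁ (≤-reflexive x≡ , yᵥ≤yᵤ)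

same-row-comparable : ∀ {u v} → vy u ≡ vy v → u ⪯ v ⊎ v ⪯ u
same-row-comparable {u} {v} y≡ with ≤-total (vx u) (vx v)
... | inj₁ xᵤ≤xᵥ = inj₁ (xᵤ≤xᵥ , ≤-reflexive (sym y≡))
... | inj₂ xᵥ≤xᵤ = inj₂ (xᵥ≤xᵤ , ≤-reflexive y≡)

tight-+-≤ : ∀ {a b c d} → a ≤ c → b ≤ d → c + d ≤ a + b → c ≤ a × d ≤ b
tight-+-≤ a≤c b≤d c+d≤a+b =
  ≮⇒≥ (λ a<c → <⇒≱ (+-mono-<-≤ a<c b≤d) c+d≤a+b) ,
  ≮⇒≥ (λ b<d → <⇒≱ (+-mono-≤-< a≤c b<d) c+d≤a+b)

≤-of-<⊎≡× : ∀ {X : Set} {a b} → a < b ⊎ (a ≡ b × X) → a ≤ b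
≤-of-<⊎≡× (inj₁ a<b) = <⇒≤ a<b
≤-of-<⊎≡× (inj₂ (a≡b , _)) = ≤-reflexive a≡b

tiebreak-of-<⊎≡× : ∀ {X : Set} {a b} → a < b ⊎ (a ≡ b × X) → b ≤ a → X
tiebreak-of-<⊎≡× (inj₁ a<b) b≤a = contradiction b≤a (<⇒≱ a<b)
tiebreak-of-<⊎≡× (inj₂ (_ , x)) _ = x

exchanged-lengths : ∀ w₁ w₂ i₁ j₁ i₂ j₂ →
  (w₂ + (i₂ + j₁)) + (w₁ + (i₁ + j₂)) ≡ (w₁ + (i₁ + j₁)) + (w₂ + (i₂ + j₂))
exchanged-lengths = solve-∀

module AlignmentGraph {A : Set} {m n : ℕ} (a : Vec A m) (b : Vec A n) where
  open Alignment a b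

  lexLe-antisym : ∀ {k k′} → LexLe k k′ → LexLe k′ k → k ≡ k′
  lexLe-antisym (inj₁ a<a′) (inj₁ a′<a) = contradiction a′<a (<-asym a<a′)
  lexLe-antisym (inj₁ a<a) (inj₂ (refl , _)) = contradiction a<a (<-irrefl refl)
  lexLe-antisym (inj₂ (refl , _)) (inj₁ a<a) = contradiction a<a (<-irrefl refl)
  lexLe-antisym (inj₂ (refl , inj₁ b<b′)) (inj₂ (_ , inj₁ b′<b)) = contradiction b′<b (<-asym b<b′)
  lexLe-antisym (inj₂ (refl , inj₁ b<b)) (inj₂ (_ , inj₂ (refl , _))) = contradiction b<b (<-irrefl refl)
  lexLe-antisym (inj₂ (refl , inj₂ (refl , _))) (inj₂ (_ , inj₁ b<b)) = contradiction b<b (<-irrefl refl)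
  lexLe-antisym (inj₂ (refl , inj₂ (refl , c≤c′))) (inj₂ (_ , inj₂ (_ , c′≤c))) =
    cong (λ c → _ , _ , c) (≤-antisym c≤c′ c′≤c)

  key-injective : ∀ {w s s′} → key w s ≡ key w s′ → s ≡ s′
  key-injective eq = vertex-≡ (cong (λ k → proj₁ (proj₂ k)) eq) (cong (λ k → proj₂ (proj₂ k)) eq)

  edge-x-mono : ∀ {u v} → Edge u v → vx u ≤ vx v
  edge-x-mono (right _ _) = n≤1+n _
  edge-x-mono (down _ _) = ≤-refl
  edge-x-mono (diag _) = n≤1+n _

  edge-y-mono : ∀ {u v} → Edge u v → vy u ≤ vy v
  edge-y-mono (right _ _) = ≤-refl
  edge-y-mono (down _ _) = n≤1+n _
  edge-y-mono (diag _) = n≤1+n _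

  edge-x-step : ∀ {u v} → Edge u v → vx v ≤ suc (vx u)
  edge-x-step (right _ _) = ≤-refl
  edge-x-step (down _ _) = n≤1+n _
  edge-x-step (diag _) = ≤-refl

  edge-y-step : ∀ {u v} → Edge u v → vy v ≤ suc (vy u)
  edge-y-step (right _ _) = n≤1+n _
  edge-y-step (down _ _) = ≤-refl
  edge-y-step (diag _) = ≤-refl

  path-x-mono : ∀ {s t k} → Path s t k → vx s ≤ vx t
  path-x-mono ([] _) = ≤-refl
  path-x-mono (e ∷ p) = ≤-trans (edge-x-mono e) (path-x-mono p)

  path-y-mono : ∀ {s t k} → Path s t k → vy s ≤ vy t
  path-y-mono ([] _) = ≤-refl
  path-y-mono (e ∷ p) = ≤-trans (edge-y-mono e) (path-y-mono p)

  path-source-inG : ∀ {s t k} → Path s t k → InG s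
  path-source-inG ([] s∈G) = s∈G
  path-source-inG (right x< y≤ ∷ _) = ≤-trans (n≤1+n _) x< , y≤
  path-source-inG (down x≤ y< ∷ _) = x≤ , ≤-trans (n≤1+n _) y<
  path-source-inG (diag (x< , y< , _) ∷ _) = <⇒≤ x< , <⇒≤ y<

  infixr 5 _++ᵖ_

  _++ᵖ_ : ∀ {s t r i j} → Path s t i → Path t r j → Path s r (i + j)
  [] _ ++ᵖ q = q
  (e ∷ p) ++ᵖ q = e ∷ (p ++ᵖ q)

  -- Without decidable equality of letters the minimum path length cannot be
  -- computed, only shown to exist up to double negation.
  shortest-path-¬¬ : ∀ {s t k} → Path s t k → ¬ ¬ ∃ (IsDist s t)
  shortest-path-¬¬ {s} {t} {k} = <-rec P shorten k
    where
    P : ℕ → Set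
    P k = Path s t k → ¬ ¬ ∃ (IsDist s t)
    shorten : ∀ k → (∀ {k′} → k′ < k → P k′) → P k
    shorten k shorter p no-shortest =
      no-shortest (k , p , λ k′ p′ → ≮⇒≥ λ k′<k → shorter k′<k p′ no-shortest)

  record PathVia (s z t : Vertex) (k : ℕ) : Set where
    constructor via
    field
      i j : ℕ
      head : Path s z i
      tail : Path z t j
      length : i + j ≡ k

  _◂_ : ∀ {s s′ z t k} → Edge s s′ → PathVia s′ z t k → PathVia s z t (suc k)
  e ◂ via i j p q eq = via (suc i) j (e ∷ p) q (cong suc eq)

  Crossing : Vertex → Vertex → ℕ → Vertex → Vertex → ℕ → Set
  Crossing s₁ t₁ k₁ s₂ t₂ k₂ = ∃ λ z → PathVia s₁ z t₁ k₁ × PathVia s₂ z t₂ k₂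

  map-first : ∀ {s₁ s₁′ t₁ k₁ s₂ t₂ k₂} → Edge s₁ s₁′ →
              Crossing s₁′ t₁ k₁ s₂ t₂ k₂ → Crossing s₁ t₁ (suc k₁) s₂ t₂ k₂
  map-first e (z , via₁ , via₂) = z , e ◂ via₁ , via₂

  map-second : ∀ {s₁ t₁ k₁ s₂ s₂′ t₂ k₂} → Edge s₂ s₂′ →
               Crossing s₁ t₁ k₁ s₂′ t₂ k₂ → Crossing s₁ t₁ k₁ s₂ t₂ (suc k₂)
  map-second e (z , via₁ , via₂) = z , via₁ , e ◂ via₂

  -- Advance the second path while it is strictly left of the first one, and
  -- the first path otherwise; unit steps keep s₂ ⪯ s₁.
  monotone-paths-cross : ∀ {s₁ t₁ k₁ s₂ t₂ k₂} → Path s₁ t₁ k₁ → Path s₂ t₂ k₂ →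
                         s₂ ⪯ s₁ → t₁ ⪯ t₂ → Crossing s₁ t₁ k₁ s₂ t₂ k₂
  monotone-paths-cross {s₁} {s₂ = s₂} p₁ p₂ s₂⪯s₁ t₁⪯t₂ with s₁ ≟ᵥ s₂ | vx s₂ <? vx s₁
  ... | yes refl | _ =
    s₁ , via 0 _ ([] (path-source-inG p₁)) p₁ refl , via 0 _ ([] (path-source-inG p₁)) p₂ refl
  monotone-paths-cross p₁ ([] _) _ t₁⪯t₂ | no _ | yes x₂<x₁ =
    contradiction (≤-trans (path-x-mono p₁) (proj₁ t₁⪯t₂)) (<⇒≱ x₂<x₁)
  monotone-paths-cross p₁ (e ∷ p₂) (_ , y₁≤y₂) t₁⪯t₂ | no _ | yes x₂<x₁ =
    map-second e (monotone-paths-cross p₁ p₂ s₂′⪯s₁ t₁⪯t₂)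
    where
    s₂′⪯s₁ = ≤-trans (edge-x-step e) x₂<x₁ , ≤-trans y₁≤y₂ (edge-y-mono e)
  ... | no s₁≢s₂ | no x₂≮x₁ = advance-first p₁ p₂ x₁≡x₂ y₁<y₂ t₁⪯t₂
    where
    x₁≡x₂ = ≤-antisym (≮⇒≥ x₂≮x₁) (proj₁ s₂⪯s₁)
    y₁<y₂ = ≤∧≢⇒< (proj₂ s₂⪯s₁) (λ y≡ → s₁≢s₂ (vertex-≡ x₁≡x₂ y≡))
    advance-first : ∀ {s₁ t₁ k₁ s₂ t₂ k₂} → Path s₁ t₁ k₁ → Path s₂ t₂ k₂ →
                    vx s₁ ≡ vx s₂ → vy s₁ < vy s₂ → t₁ ⪯ t₂ → Crossing s₁ t₁ k₁ s₂ t₂ k₂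
    advance-first ([] _) p₂ _ y₁<y₂ t₁⪯t₂ =
      contradiction (≤-trans (path-y-mono p₂) (proj₂ t₁⪯t₂)) (<⇒≱ y₁<y₂)
    advance-first (e ∷ p₁) p₂ x₁≡x₂ y₁<y₂ t₁⪯t₂ =
      map-first e (monotone-paths-cross p₁ p₂ s₂⪯s₁′ t₁⪯t₂)
      where
      s₂⪯s₁′ = ≤-trans (≤-reflexive (sym x₁≡x₂)) (edge-x-mono e) , ≤-trans (edge-y-step e) y₁<y₂

  side-boundary-inRect : ∀ side {P u} → SideBoundary side P u → InRect P u
  side-boundary-inRect topLeftSide (((_ , u∈P) , _) , _) = u∈P
  side-boundary-inRect bottomRightSide (((_ , u∈P) , _) , _) = u∈P

  side-boundary-chain : ∀ side {P u v} → SideBoundary side P u → SideBoundary side P v →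
                        u ⪯ v ⊎ v ⪯ u
  side-boundary-chain topLeftSide (((_ , _ , _ , y₀≤yᵤ , _) , _) , inj₁ xᵤ≡x₀)
                                  (((_ , x₀≤xᵥ , _ , _ , _) , _) , inj₂ yᵥ≡y₀) =
    inj₁ (≤-trans (≤-reflexive xᵤ≡x₀) x₀≤xᵥ , ≤-trans (≤-reflexive yᵥ≡y₀) y₀≤yᵤ)
  side-boundary-chain topLeftSide (((_ , x₀≤xᵤ , _ , _ , _) , _) , inj₂ yᵤ≡y₀)
                                  (((_ , _ , _ , y₀≤yᵥ , _) , _) , inj₁ xᵥ≡x₀) =
    inj₂ (≤-trans (≤-reflexive xᵥ≡x₀) x₀≤xᵤ , ≤-trans (≤-reflexive yᵤ≡y₀) y₀≤yᵥ)
  side-boundary-chain topLeftSide (_ , inj₁ xᵤ≡x₀) (_ , inj₁ xᵥ≡x₀) =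
    same-column-comparable (trans xᵤ≡x₀ (sym xᵥ≡x₀))
  side-boundary-chain topLeftSide (_ , inj₂ yᵤ≡y₀) (_ , inj₂ yᵥ≡y₀) =
    same-row-comparable (trans yᵤ≡y₀ (sym yᵥ≡y₀))
  side-boundary-chain bottomRightSide (((_ , _ , _ , _ , yᵤ≤y₁) , _) , inj₁ xᵤ≡x₁)
                                      (((_ , _ , xᵥ≤x₁ , _ , _) , _) , inj₂ yᵥ≡y₁) =
    inj₂ (≤-trans xᵥ≤x₁ (≤-reflexive (sym xᵤ≡x₁)) , ≤-trans yᵤ≤y₁ (≤-reflexive (sym yᵥ≡y₁)))
  side-boundary-chain bottomRightSide (((_ , _ , xᵤ≤x₁ , _ , _) , _) , inj₂ yᵤ≡y₁)
                                      (((_ , _ , _ , _ , yᵥ≤y₁) , _) , inj₁ xᵥ≡x₁) =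
    inj₁ (≤-trans xᵤ≤x₁ (≤-reflexive (sym xᵥ≡x₁)) , ≤-trans yᵥ≤y₁ (≤-reflexive (sym yᵤ≡y₁)))
  side-boundary-chain bottomRightSide (_ , inj₁ xᵤ≡x₁) (_ , inj₁ xᵥ≡x₁) =
    same-column-comparable (trans xᵤ≡x₁ (sym xᵥ≡x₁))
  side-boundary-chain bottomRightSide (_ , inj₂ yᵤ≡y₁) (_ , inj₂ yᵥ≡y₁) =
    same-row-comparable (trans yᵤ≡y₁ (sym yᵥ≡y₁))

  -- Inside P, pos P v = (vx v − x₀) + (y₁ − vy v) with both summands
  -- ⪯-monotone, so v ⪯ u and pos P u ≤ pos P v force u and v to coincide.
  pos-reflects-⪯ : ∀ {P u v} → InRect P u → InRect P v → v ⪯ u → pos P u ≤ pos P v → u ⪯ v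
  pos-reflects-⪯ {P} (x₀≤xᵤ , _) (x₀≤xᵥ , _ , _ , yᵥ≤y₁) (xᵥ≤xᵤ , yᵤ≤yᵥ) posᵤ≤posᵥ =
    ≤-reflexive (∸-cancelʳ-≡ x₀≤xᵤ x₀≤xᵥ (≤-antisym Δxᵤ≤Δxᵥ Δxᵥ≤Δxᵤ)) ,
    ∸-cancelʳ-≤ yᵥ≤y₁ Δyᵤ≤Δyᵥ
    where
    Δxᵥ≤Δxᵤ = ∸-monoˡ-≤ (x0 P) xᵥ≤xᵤ
    tight = tight-+-≤ Δxᵥ≤Δxᵤ (∸-monoʳ-≤ (y1 P) yᵤ≤yᵥ) posᵤ≤posᵥ
    Δxᵤ≤Δxᵥ = proj₁ tight
    Δyᵤ≤Δyᵥ = proj₂ tight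

  boundary-order : ∀ side {P u v} → SideBoundary side P u → SideBoundary side P v →
                   pos P u ≤ pos P v → u ⪯ v
  boundary-order side u∈X v∈X posᵤ≤posᵥ with side-boundary-chain side u∈X v∈X
  ... | inj₁ u⪯v = u⪯v
  ... | inj₂ v⪯u =
    pos-reflects-⪯ (side-boundary-inRect side u∈X) (side-boundary-inRect side v∈X) v⪯u posᵤ≤posᵥ

  Nearest : (Vertex → Set) → (Vertex → ℕ) → Vertex → Vertex → ℕ → Set
  Nearest U w s t d = ∀ s′ d′ → U s′ → IsDist s′ t d′ →
    (w s + d < w s′ + d′) ⊎ ((w s + d ≡ w s′ + d′) × LexLe (key w s′) (key w s))

  crossing-nearest-sites-agree : ∀ (U : Vertex → Set) (w : Vertex → ℕ) {s₁ t₁ d₁ s₂ t₂ d₂ z} →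
    U s₁ → U s₂ → Nearest U w s₁ t₁ d₁ → Nearest U w s₂ t₂ d₂ →
    PathVia s₁ z t₁ d₁ → PathVia s₂ z t₂ d₂ → s₁ ≡ s₂
  crossing-nearest-sites-agree U w {s₁} {t₁} {_} {s₂} {t₂} s₁∈U s₂∈U near₁ near₂
                               (via i₁ j₁ p₁ q₁ refl) (via i₂ j₂ p₂ q₂ refl) =
    decidable-stable (s₁ ≟ᵥ s₂) λ s₁≢s₂ →
      shortest-path-¬¬ (p₂ ++ᵖ q₁) λ (_ , dist₂₁) →
      shortest-path-¬¬ (p₁ ++ᵖ q₂) λ (_ , dist₁₂) →
      s₁≢s₂ (swapped-tails-tie dist₂₁ dist₁₂)
    where
    swapped-tails-tie : ∀ {D₂₁ D₁₂} → IsDist s₂ t₁ D₂₁ → IsDist s₁ t₂ D₁₂ → s₁ ≡ s₂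
    swapped-tails-tie {D₂₁} {D₁₂} dist₂₁@(_ , min₂₁) dist₁₂@(_ , min₁₂) =
      sym (key-injective (lexLe-antisym (tiebreak-of-<⊎≡× beats₂₁ tie₁) (tiebreak-of-<⊎≡× beats₁₂ tie₂)))
      where
      beats₂₁ = near₁ s₂ D₂₁ s₂∈U dist₂₁
      beats₁₂ = near₂ s₁ D₁₂ s₁∈U dist₁₂
      no-longer : (w s₂ + D₂₁) + (w s₁ + D₁₂) ≤ (w s₁ + (i₁ + j₁)) + (w s₂ + (i₂ + j₂))
      no-longer = begin
        (w s₂ + D₂₁) + (w s₁ + D₁₂)
          ≤⟨ +-mono-≤ (+-monoʳ-≤ (w s₂) (min₂₁ _ (p₂ ++ᵖ q₁))) (+-monoʳ-≤ (w s₁) (min₁₂ _ (p₁ ++ᵖ q₂))) ⟩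
        (w s₂ + (i₂ + j₁)) + (w s₁ + (i₁ + j₂))
          ≡⟨ exchanged-lengths (w s₁) (w s₂) i₁ j₁ i₂ j₂ ⟩
        (w s₁ + (i₁ + j₁)) + (w s₂ + (i₂ + j₂)) ∎
        where open ≤-Reasoning
      tie₁ = proj₁ (tight-+-≤ (≤-of-<⊎≡× beats₂₁) (≤-of-<⊎≡× beats₁₂) no-longer)
      tie₂ = proj₂ (tight-+-≤ (≤-of-<⊎≡× beats₂₁) (≤-of-<⊎≡× beats₁₂) no-longer)

lemma4p1 : {A : Set} {m n : ℕ} (a : Vec A m) (b : Vec A n) →
    let open Alignment a b in
    (D : Decomp Whole) (Q H : Rect) → PieceOf D Q → PieceOf D H →
    (U : Vertex → Set) → (∀ s → U s → BottomRight Q s) →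
    (w : Vertex → ℕ) → (side : Side) →
    (u v sᵤ sᵥ : Vertex) →
    SideBoundary side H u × Outside Q u →
    SideBoundary side H v × Outside Q v →
    InCell Q U w u sᵤ → InCell Q U w v sᵥ → sᵤ ≢ sᵥ →
    Precedes H u v → Precedes Q sᵤ sᵥ
lemma4p1 a b _ Q H _ _ U U⊆BR w side u v sᵤ sᵥ (u∈X , _) (v∈X , _)
         (_ , sᵤ∈U , _ , (pᵤ , _) , sᵤ-nearest) (_ , sᵥ∈U , _ , (pᵥ , _) , sᵥ-nearest) sᵤ≢sᵥ u<v =
  decidable-stable (_ <? _) λ sᵤ≮sᵥ →
    let sᵥ⪯sᵤ = boundary-order bottomRightSide (U⊆BR sᵥ sᵥ∈U) (U⊆BR sᵤ sᵤ∈U) (≮⇒≥ sᵤ≮sᵥ)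
        u⪯v = boundary-order side u∈X v∈X (<⇒≤ u<v)
        (_ , viaᵤ , viaᵥ) = monotone-paths-cross pᵤ pᵥ sᵥ⪯sᵤ u⪯v
    in sᵤ≢sᵥ (crossing-nearest-sites-agree U w sᵤ∈U sᵥ∈U sᵤ-nearest sᵥ-nearest viaᵤ viaᵥ)
  where
  open Alignment a b
  open AlignmentGraph a b
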